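{- Let $f:\mathbb{N}\to\mathbb{N}$ be an increasing function with $f(0)>0$. For every type $\tau$ (finite multiset of natural numbers) and every $t\in\mathbb{N}$, \[ L_{\tau}(t)\;\leq\;\max_{k\in\tau}\bigl\{1+L_{\tau_{\langle k,t\rangle}}(t+1)\bigr\}, \] with the convention $\max\emptyset=0$.
   Context: A type is a finite multiset $\tau$ of natural numbers. For $\tau=\{k_i\mid i\in I\}$, $\mathbb{N}^\tau$ denotes the disjoint union $\sum_{i\in I}\mathbb{N}^{k_i}$ (so $\mathbb{N}^{\{k\}}=\mathbb{N}^k$, $\mathbb{N}^\emptyset=\emptyset$, and $\mathbb{N}^0=\{\langle\rangle\}$), ordered by the sum of the product orderings: $x\le y$ iff $x,y$ lie in the same summand $\mathbb{N}^{k_i}$ and $x[j]\le y[j]$ for all coordinates $j$. Types are added and scaled as multisets: $(\tau_1+\tau_2)(k)=\tau_1(k)+\tau_2(k)$, $(p\times\tau)(k)=p\cdot\tau(k)$, and $\tau-\tau_1$ is defined when $\tau_1\subseteq\tau$. The norm $\|x\|_\infty$ is the maximum coordinate of $x$ (0 for the empty tuple). A sequence $x_0,\dots,x_l$ over $\mathbb{N}^\tau$ is $t$-controlled if $\|x_i\|_\infty<f(i+t)$ for all $i$; it is bad if there are no indices $i<j$ with $x_i\le x_j$. $L_\tau(t)$ is the maximal length of a $t$-controlled bad sequence over $\mathbb{N}^\tau$. Let $N_k(t)=k\cdot(f(t)-1)$, and for $k\in\tau$ let $\tau_{\langle k,t\rangle}=\tau-\{k\}+N_k(t)\times\{k-1\}$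 (for $k=0$ this is $\tau-\{0\}$). -}

module Defs where

open import Data.Nat using (ℕ; zero; suc; _+_; _*_; _∸_; _≤_; _<_; _⊔_)
open import Data.Fin using (Fin; toℕ) renaming (zero to fzero; suc to fsuc)
open import Data.List using (List; length; lookup; removeAt; replicate; _++_)
open import Data.Vec using (Vec; []; _∷_)
open import Data.Vec.Relation.Binary.Pointwise.Inductive using (Pointwise)
open import Data.Product using (Σ; _,_; _×_; ∃)
open import Relation.Nullary using (¬_)

-- A type τ is a finite multiset of naturals, represented by a list
-- (all notions below are invariant under permutation of the list).
Type : Set
Type = List ℕ

-- Elements of ℕ^τ: a summand index i together with a tuple in ℕ^(τ[i]).
Elem : Type → Set
Elem τ = Σ (Fin (length τ)) (λ i → Vec ℕ (lookup τ i))

data _≤E_ {τ : Type} : Elem τ → Elem τ → Set where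
  same : ∀ {i} {u v : Vec ℕ (lookup τ i)} → Pointwise _≤_ u v → (i , u) ≤E (i , v)

normV : ∀ {k} → Vec ℕ k → ℕ
normV []       = 0
normV (x ∷ xs) = x ⊔ normV xs

norm : (τ : Type) → Elem τ → ℕ
norm τ (_ , u) = normV u

Seq : Type → ℕ → Set
Seq τ l = Fin l → Elem τ

Controlled : (f : ℕ → ℕ) → (τ : Type) → ∀ {l} → ℕ → Seq τ l → Set
Controlled f τ t xs = ∀ i → norm τ (xs i) < f (toℕ i + t)

Bad : (τ : Type) → ∀ {l} → Seq τ l → Set
Bad τ {l} xs = ∀ (i j : Fin l) → toℕ i < toℕ j → ¬ (_≤E_ {τ} (xs i) (xs j))

IsL : (f : ℕ → ℕ) → Type → ℕ → ℕ → Set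
IsL f τ t n =
  (Σ (Seq τ n) λ xs → Controlled f τ t xs × Bad τ xs) ×
  (∀ l (xs : Seq τ l) → Controlled f τ t xs → Bad τ xs → l ≤ n)

N : (f : ℕ → ℕ) → ℕ → ℕ → ℕ
N f k t = k * (f t ∸ 1)

derive : (f : ℕ → ℕ) → (τ : Type) → Fin (length τ) → ℕ → Type
derive f τ i t = removeAt τ i ++ replicate (N f (lookup τ i) t) (lookup τ i ∸ 1)

maxFin : ∀ {n} → (Fin n → ℕ) → ℕ
maxFin {zero}  g = 0
maxFin {suc n} g = g fzero ⊔ maxFin (λ i → g (fsuc i))

module Submission where

-- Let x₀, x₁, …, xₙ be a t-controlled bad sequence over ℕ^τ, with x₀ = (i, u₀)
-- in the summand ℕ^k, k = τ[i]; control gives ‖u₀‖ < f(t).  Since the sequence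
-- is bad, no later xⱼ lies above x₀, so each xⱼ (j ≥ 1) is either
--   * in another summand, hence an element of ℕ^(τ − {k}), or
--   * a tuple u ∈ ℕ^k with u[c] < u₀[c] < f(t) at some coordinate c; the pair
--     (c, u[c]) ranges over k·(f(t) − 1) = N_k(t) values, so u is recorded as
--     the copy number (c, u[c]) of ℕ^(k−1) together with u with coordinate c
--     deleted.
-- This defines a map from the tail x₁, …, xₙ into ℕ^τ⟨k,t⟩ that does not
-- increase norms and reflects the ordering, so the tail becomes a
-- (t+1)-controlled bad sequence over ℕ^τ⟨k,t⟩ and n ≤ L_τ⟨k,t⟩(t+1).

open import Defs
open import Data.Nat using (ℕ; suc; _≤_; _<_)
open import Data.Fin using (Fin)
open import Data.List using (length)

open import Data.Nat using (zero; _*_; _∸_; z≤n; s≤s; s<s⁻¹; _<?_)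
open import Data.Nat.Properties
  using (≤-trans; ≤-reflexive; ≤-<-trans; m≤m⊔n; m≤n⊔m; ⊔-monoʳ-≤; ≮⇒≥; +-suc)
open import Data.Fin using (toℕ; fromℕ<; combine; _≟_) renaming (zero to fzero; suc to fsuc)
open import Data.Fin.Properties using (combine-injective; fromℕ<-injective)
open import Data.List using ([]; _∷_; lookup; removeAt; replicate; _++_)
open import Data.Vec using (Vec; []; _∷_) renaming (lookup to vlookup; removeAt to vremoveAt)
open import Data.Vec.Relation.Binary.Pointwise.Inductive using (Pointwise; []; _∷_)
open import Data.Product using (∃; _,_; _×_; proj₁; proj₂; map₁; uncurry)
open import Function using (_∘_)
open import Relation.Nullary using (¬_; Dec; yes; no)
open import Relation.Binary.PropositionalEquality using (_≡_; _≢_; refl; cong; sym; trans; subst)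
open import Data.Empty using (⊥-elim)

-- The ordering of ℕ^τ with τ explicit (Elem τ does not determine τ).
Below : (τ : Type) → Elem τ → Elem τ → Set
Below τ = _≤E_ {τ}

syntax Below τ x y = x ≤[ τ ] y

there : ∀ {a σ} → Elem σ → Elem (a ∷ σ)
there (p , u) = fsuc p , u

there-mono : ∀ {a σ} {x y : Elem σ} → x ≤[ σ ] y → there x ≤[ a ∷ σ ] there y
there-mono (same le) = same le

there-reflects : ∀ {a σ} {x y : Elem σ} → there x ≤[ a ∷ σ ] there y → x ≤[ σ ] y
there-reflects (same le) = same le

inl : ∀ σ {ρ} → Elem σ → Elem (σ ++ ρ)
inl (a ∷ σ) (fzero , u)  = fzero , u
inl (a ∷ σ) (fsuc p , u) = there (inl σ (p , u))

inr : ∀ σ {ρ} → Elem ρ → Elem (σ ++ ρ)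
inr []      x = x
inr (a ∷ σ) x = there (inr σ x)

inl-norm : ∀ σ {ρ} (x : Elem σ) → norm (σ ++ ρ) (inl σ x) ≡ norm σ x
inl-norm (a ∷ σ) (fzero , u)  = refl
inl-norm (a ∷ σ) (fsuc p , u) = inl-norm σ (p , u)

inr-norm : ∀ σ {ρ} (x : Elem ρ) → norm (σ ++ ρ) (inr σ x) ≡ norm ρ x
inr-norm []      x = refl
inr-norm (a ∷ σ) x = inr-norm σ x

inl-reflects : ∀ σ {ρ} (x y : Elem σ) → inl σ x ≤[ σ ++ ρ ] inl σ y → x ≤[ σ ] y
inl-reflects (a ∷ σ) (fzero , u)  (fzero , v)  (same le) = same le
inl-reflects (a ∷ σ) (fzero , u)  (fsuc q , v) ()
inl-reflects (a ∷ σ) (fsuc p , u) (fzero , v)  ()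
inl-reflects (a ∷ σ) (fsuc p , u) (fsuc q , v) le =
  there-mono (inl-reflects σ (p , u) (q , v) (there-reflects le))

inr-reflects : ∀ σ {ρ} (x y : Elem ρ) → inr σ x ≤[ σ ++ ρ ] inr σ y → x ≤[ ρ ] y
inr-reflects []      x y le = le
inr-reflects (a ∷ σ) x y le = inr-reflects σ x y (there-reflects le)

inl≰inr : ∀ σ {ρ} (x : Elem σ) (y : Elem ρ) → ¬ inl σ x ≤[ σ ++ ρ ] inr σ y
inl≰inr (a ∷ σ) (fzero , u)  y ()
inl≰inr (a ∷ σ) (fsuc p , u) y le = inl≰inr σ (p , u) y (there-reflects le)

inr≰inl : ∀ σ {ρ} (x : Elem ρ) (y : Elem σ) → ¬ inr σ x ≤[ σ ++ ρ ] inl σ y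
inr≰inl (a ∷ σ) x (fzero , v)  ()
inr≰inl (a ∷ σ) x (fsuc q , v) le = inr≰inl σ x (q , v) (there-reflects le)

dropSummand : ∀ τ i (x : Elem τ) → proj₁ x ≢ i → Elem (removeAt τ i)
dropSummand (a ∷ σ) fzero    (fzero , u)  ne = ⊥-elim (ne refl)
dropSummand (a ∷ σ) fzero    (fsuc j , u) ne = j , u
dropSummand (a ∷ σ) (fsuc i) (fzero , u)  ne = fzero , u
dropSummand (a ∷ σ) (fsuc i) (fsuc j , u) ne = there (dropSummand σ i (j , u) (ne ∘ cong fsuc))

dropSummand-norm : ∀ τ i (x : Elem τ) (ne : proj₁ x ≢ i) →
  norm (removeAt τ i) (dropSummand τ i x ne) ≡ norm τ x
dropSummand-norm (a ∷ σ) fzero    (fzero , u)  ne = ⊥-elim (ne refl)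
dropSummand-norm (a ∷ σ) fzero    (fsuc j , u) ne = refl
dropSummand-norm (a ∷ σ) (fsuc i) (fzero , u)  ne = refl
dropSummand-norm (a ∷ σ) (fsuc i) (fsuc j , u) ne = dropSummand-norm σ i (j , u) (ne ∘ cong fsuc)

dropSummand-reflects : ∀ τ i (x y : Elem τ) (nx : proj₁ x ≢ i) (ny : proj₁ y ≢ i) →
  dropSummand τ i x nx ≤[ removeAt τ i ] dropSummand τ i y ny → x ≤[ τ ] y
dropSummand-reflects (a ∷ σ) fzero (fzero , u) y nx ny le = ⊥-elim (nx refl)
dropSummand-reflects (a ∷ σ) fzero (fsuc j , u) (fzero , v) nx ny le = ⊥-elim (ny refl)
dropSummand-reflects (a ∷ σ) fzero (fsuc j , u) (fsuc q , v) nx ny le = there-mono le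
dropSummand-reflects (a ∷ σ) (fsuc i) (fzero , u) (fzero , v) nx ny (same le) = same le
dropSummand-reflects (a ∷ σ) (fsuc i) (fzero , u) (fsuc q , v) nx ny ()
dropSummand-reflects (a ∷ σ) (fsuc i) (fsuc j , u) (fzero , v) nx ny ()
dropSummand-reflects (a ∷ σ) (fsuc i) (fsuc j , u) (fsuc q , v) nx ny le =
  there-mono (dropSummand-reflects σ i (j , u) (q , v) (nx ∘ cong fsuc) (ny ∘ cong fsuc)
               (there-reflects le))

copy : ∀ {m c} → Fin m → Vec ℕ c → Elem (replicate m c)
copy fzero    w = fzero , w
copy (fsuc q) w = there (copy q w)

copy-norm : ∀ {m c} (q : Fin m) (w : Vec ℕ c) → norm (replicate m c) (copy q w) ≡ normV w
copy-norm fzero    w = refl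
copy-norm (fsuc q) w = copy-norm q w

copy-reflects : ∀ {m c} (q q' : Fin m) (w w' : Vec ℕ c) →
  copy q w ≤[ replicate m c ] copy q' w' → q ≡ q' × Pointwise _≤_ w w'
copy-reflects fzero    fzero     w w' (same le) = refl , le
copy-reflects fzero    (fsuc q') w w' ()
copy-reflects (fsuc q) fzero     w w' ()
copy-reflects (fsuc q) (fsuc q') w w' le =
  map₁ (cong fsuc) (copy-reflects q q' w w' (there-reflects le))

lookup≤normV : ∀ {k} (u : Vec ℕ k) c → vlookup u c ≤ normV u
lookup≤normV (x ∷ xs) fzero    = m≤m⊔n x (normV xs)
lookup≤normV (x ∷ xs) (fsuc c) = ≤-trans (lookup≤normV xs c) (m≤n⊔m x (normV xs))

removeAt-normV : ∀ {k} (u : Vec ℕ (suc k)) c → normV (vremoveAt u c) ≤ normV u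
removeAt-normV (x ∷ xs)     fzero    = m≤n⊔m x (normV xs)
removeAt-normV (x ∷ y ∷ xs) (fsuc c) = ⊔-monoʳ-≤ x (removeAt-normV (y ∷ xs) c)

removeAt-reflects : ∀ {k} (u v : Vec ℕ (suc k)) c →
  Pointwise _≤_ (vremoveAt u c) (vremoveAt v c) → vlookup u c ≤ vlookup v c → Pointwise _≤_ u v
removeAt-reflects (x ∷ xs)      (y ∷ ys)      fzero    pw        le  = le ∷ pw
removeAt-reflects (x ∷ x' ∷ xs) (y ∷ y' ∷ ys) (fsuc c) (le ∷ pw) le' =
  le ∷ removeAt-reflects (x' ∷ xs) (y' ∷ ys) c pw le'

escape : ∀ {k} (u₀ u : Vec ℕ k) → ¬ Pointwise _≤_ u₀ u → ∃ λ c → vlookup u c < vlookup u₀ c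
escape []       []       nle = ⊥-elim (nle [])
escape (a ∷ u₀) (b ∷ u) nle with b <? a
... | yes b<a = fzero , b<a
... | no b≮a  with escape u₀ u (λ pw → nle (≮⇒≥ b≮a ∷ pw))
...   | c , lt = fsuc c , lt

escape-bound : ∀ {k F} (u₀ u : Vec ℕ k) c →
  vlookup u c < vlookup u₀ c → normV u₀ < F → vlookup u c < F ∸ 1
escape-bound {F = suc F} u₀ u c lt h = s<s⁻¹ (≤-<-trans (≤-trans lt (lookup≤normV u₀ c)) h)

code : ∀ {k} F (u₀ u : Vec ℕ (suc k)) → ∃ (λ c → vlookup u c < vlookup u₀ c) → normV u₀ < F →
  Fin (suc k * (F ∸ 1)) × Vec ℕ k
code F u₀ u (c , lt) h = combine c (fromℕ< (escape-bound u₀ u c lt h)) , vremoveAt u c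

code-reflects : ∀ {k F} (u₀ u u' : Vec ℕ (suc k)) e e' (h : normV u₀ < F) →
  proj₁ (code F u₀ u e h) ≡ proj₁ (code F u₀ u' e' h) →
  Pointwise _≤_ (proj₂ (code F u₀ u e h)) (proj₂ (code F u₀ u' e' h)) → Pointwise _≤_ u u'
code-reflects u₀ u u' (c , lt) (c' , lt') h same-index pw
  with combine-injective c _ c' _ same-index
... | refl , same-value =
  removeAt-reflects u u' c pw (≤-reflexive (fromℕ<-injective _ _ _ _ same-value))

encode : ∀ {k} F (u₀ u : Vec ℕ k) → ¬ Pointwise _≤_ u₀ u → normV u₀ < F →
  Fin (k * (F ∸ 1)) × Vec ℕ (k ∸ 1)
encode {zero}  F [] [] nle h = ⊥-elim (nle [])
encode {suc k} F u₀ u  nle h = code F u₀ u (escape u₀ u nle) h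

encode-norm : ∀ {k} F (u₀ u : Vec ℕ k) nle h → normV (proj₂ (encode F u₀ u nle h)) ≤ normV u
encode-norm {zero}  F [] [] nle h = ⊥-elim (nle [])
encode-norm {suc k} F u₀ u  nle h = removeAt-normV u _

encode-reflects : ∀ {k} F (u₀ u u' : Vec ℕ k) nle nle' h →
  proj₁ (encode F u₀ u nle h) ≡ proj₁ (encode F u₀ u' nle' h) →
  Pointwise _≤_ (proj₂ (encode F u₀ u nle h)) (proj₂ (encode F u₀ u' nle' h)) →
  Pointwise _≤_ u u'
encode-reflects {zero}  F [] [] [] nle nle' h = ⊥-elim (nle [])
encode-reflects {suc k} F u₀ u  u' nle nle' h =
  code-reflects u₀ u u' (escape u₀ u nle) (escape u₀ u' nle') h

module Derivative (f : ℕ → ℕ) (τ : Type) (t : ℕ) (i : Fin (length τ))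
                  (u₀ : Vec ℕ (lookup τ i)) (u₀-small : normV u₀ < f t) where

  private
    rest : Type
    rest = removeAt τ i

    D : Type
    D = derive f τ i t

  codeOf : (u : Vec ℕ (lookup τ i)) → ¬ Pointwise _≤_ u₀ u →
    Fin (N f (lookup τ i) t) × Vec ℕ (lookup τ i ∸ 1)
  codeOf u nle = encode (f t) u₀ u nle u₀-small

  embedAt : (x : Elem τ) → ¬ (i , u₀) ≤[ τ ] x → Dec (proj₁ x ≡ i) → Elem D
  embedAt (j , u) nle (yes refl) = inr rest (uncurry copy (codeOf u (nle ∘ same)))
  embedAt x nle (no ne) = inl rest (dropSummand τ i x ne)

  embedAt-norm : ∀ x nle d → norm D (embedAt x nle d) ≤ norm τ x
  embedAt-norm (j , u) nle (yes refl) =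
    ≤-trans (≤-reflexive (trans (inr-norm rest _) (copy-norm (proj₁ c) (proj₂ c))))
            (encode-norm (f t) u₀ u (nle ∘ same) u₀-small)
    where c = codeOf u (nle ∘ same)
  embedAt-norm x nle (no ne) = ≤-reflexive (trans (inl-norm rest _) (dropSummand-norm τ i x ne))

  embedAt-reflects : ∀ x nx dx y ny dy → embedAt x nx dx ≤[ D ] embedAt y ny dy → x ≤[ τ ] y
  embedAt-reflects (j , u) nx (yes refl) (j' , u') ny (yes refl) le
    with copy-reflects _ _ _ _ (inr-reflects rest _ _ le)
  ... | same-index , pw = same (encode-reflects (f t) u₀ u u' _ _ u₀-small same-index pw)
  embedAt-reflects (j , u) nx (yes refl) y ny (no ne) le = ⊥-elim (inr≰inl rest _ _ le)
  embedAt-reflects x nx (no ne) (j , u) ny (yes refl) le = ⊥-elim (inl≰inr rest _ _ le)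
  embedAt-reflects x nx (no ne) y ny (no ne') le =
    dropSummand-reflects τ i x y ne ne' (inl-reflects rest _ _ le)

  embed : (x : Elem τ) → ¬ (i , u₀) ≤[ τ ] x → Elem D
  embed x nle = embedAt x nle (proj₁ x ≟ i)

  embed-norm : ∀ x nle → norm D (embed x nle) ≤ norm τ x
  embed-norm x nle = embedAt-norm x nle (proj₁ x ≟ i)

  embed-reflects : ∀ x nx y ny → embed x nx ≤[ D ] embed y ny → x ≤[ τ ] y
  embed-reflects x nx y ny = embedAt-reflects x nx (proj₁ x ≟ i) y ny (proj₁ y ≟ i)

tail-controlled : ∀ f τ {l t} (xs : Seq τ (suc l)) →
  Controlled f τ t xs → Controlled f τ (suc t) (xs ∘ fsuc)
tail-controlled f τ {t = t} xs ctrl j =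
  subst (λ s → norm τ (xs (fsuc j)) < f s) (sym (+-suc (toℕ j) t)) (ctrl (fsuc j))

tail-bad : ∀ τ {l} (xs : Seq τ (suc l)) → Bad τ xs → Bad τ (xs ∘ fsuc)
tail-bad τ xs bad j j' j<j' = bad (fsuc j) (fsuc j') (s≤s j<j')

transfer-controlled : ∀ f σ ρ {l t} (xs : Seq σ l) (ys : Seq ρ l) →
  (∀ j → norm ρ (ys j) ≤ norm σ (xs j)) → Controlled f σ t xs → Controlled f ρ t ys
transfer-controlled f σ ρ xs ys smaller ctrl j = ≤-<-trans (smaller j) (ctrl j)

transfer-bad : ∀ σ ρ {l} (xs : Seq σ l) (ys : Seq ρ l) →
  (∀ j j' → ys j ≤[ ρ ] ys j' → xs j ≤[ σ ] xs j') → Bad σ xs → Bad ρ ys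
transfer-bad σ ρ xs ys reflects bad j j' j<j' = bad j j' j<j' ∘ reflects j j'

maxFin-upper : ∀ {m} (g : Fin m → ℕ) i → g i ≤ maxFin g
maxFin-upper g fzero    = m≤m⊔n (g fzero) _
maxFin-upper g (fsuc i) = ≤-trans (maxFin-upper (g ∘ fsuc) i) (m≤n⊔m (g fzero) _)

theorem1 : (f : ℕ → ℕ) → (∀ {m n} → m ≤ n → f m ≤ f n) → 0 < f 0 →
    (τ : Type) (t : ℕ) (n : ℕ) → IsL f τ t n →
    (L' : Fin (length τ) → ℕ) →
    (∀ i → IsL f (derive f τ i t) (suc t) (L' i)) →
    n ≤ maxFin (λ i → suc (L' i))
theorem1 f _ _ τ t zero    _                               L' isL' = z≤n
theorem1 f _ _ τ t (suc n) ((xs , controlled , bad) , _) L' isL' =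
  ≤-trans (s≤s (proj₂ (isL' i) n ys ys-controlled ys-bad)) (maxFin-upper (suc ∘ L') i)
  where
  i : Fin (length τ)
  i = proj₁ (xs fzero)

  D : Type
  D = derive f τ i t

  open Derivative f τ t i (proj₂ (xs fzero)) (controlled fzero)

  escapes : ∀ j → ¬ xs fzero ≤[ τ ] xs (fsuc j)
  escapes j = bad fzero (fsuc j) (s≤s z≤n)

  ys : Seq D n
  ys j = embed (xs (fsuc j)) (escapes j)

  ys-controlled : Controlled f D (suc t) ys
  ys-controlled = transfer-controlled f τ D (xs ∘ fsuc) ys (λ j → embed-norm _ (escapes j))
                    (tail-controlled f τ xs controlled)

  ys-bad : Bad D ys
  ys-bad = transfer-bad τ D (xs ∘ fsuc) ys (λ j j' → embed-reflects _ (escapes j) _ (escapes j'))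
             (tail-bad τ xs bad)
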